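{- If $p>5$ is a prime and $A\subseteq\mathbb{F}_p$ satisfies $A-A\doteq\mathcal{R}_p$, then $|M_A|$ is odd; that is, $-1\notin M_A$.
   Context: $\mathcal{R}_p$ is the set of non-zero quadratic residues modulo $p$. $A-A\doteq\mathcal{R}_p$ means: every element of $\mathcal{R}_p$ has exactly one representation as $a'-a''$ with $a',a''\in A$, and every difference $a'-a''$ with $a',a''\in A$, $a'\neq a''$, lies in $\mathcal{R}_p$. An element $\mu\in\mathbb{F}_p^\times$ is a multiplier of $A$ if there is $g\in\mathbb{F}_p$ with $\{\mu a:a\in A\}=A+g$; the multipliers form a subgroup $M_A$ of $\mathbb{F}_p^\times$ (the multiplier subgroup of $A$). -}

module Defs where

open import Data.Nat using (ℕ; zero; suc; _+_; _*_; _∸_; _<_; NonZero)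
open import Data.Nat.DivMod using (_%_; m%n<n)
open import Data.Fin using (Fin; toℕ; fromℕ<)
open import Data.Fin.Subset using (Subset; _∈_)
open import Data.Product using (Σ; _×_; _,_; ∃)
open import Data.List using (List; length)
open import Relation.Binary.PropositionalEquality using (_≡_; _≢_)
import Data.List.Membership.Propositional as LM
open import Data.List.Relation.Unary.Unique.Propositional using (Unique)

-- The field F_p is modelled as Fin p with arithmetic modulo p.
module _ {p : ℕ} .{{_ : NonZero p}} where

  infixl 6 _⊕_ _⊖_
  infixl 7 _⊗_

  _⊕_ : Fin p → Fin p → Fin p
  a ⊕ b = fromℕ< (m%n<n (toℕ a + toℕ b) p)

  _⊖_ : Fin p → Fin p → Fin p
  a ⊖ b = fromℕ< (m%n<n (toℕ a + (p ∸ toℕ b)) p)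

  _⊗_ : Fin p → Fin p → Fin p
  a ⊗ b = fromℕ< (m%n<n (toℕ a * toℕ b) p)

  minusOne : Fin p
  minusOne = fromℕ< (m%n<n (p ∸ 1) p)

  NonZeroF : Fin p → Set
  NonZeroF x = toℕ x ≢ 0

  IsQR : Fin p → Set
  IsQR x = NonZeroF x × ∃ λ y → y ⊗ y ≡ x

  RepDiff : Subset p → Fin p → Fin p × Fin p → Set
  RepDiff A r (a₁ , a₂) = a₁ ∈ A × a₂ ∈ A × a₁ ⊖ a₂ ≡ r

  DiffIsQR : Subset p → Set
  DiffIsQR A =
    (∀ r → IsQR r →
       Σ (Fin p × Fin p) λ q → RepDiff A r q × (∀ q' → RepDiff A r q' → q' ≡ q))
    × (∀ a₁ a₂ → a₁ ∈ A → a₂ ∈ A → a₁ ≢ a₂ → IsQR (a₁ ⊖ a₂))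

  IsMultiplier : Subset p → Fin p → Set
  IsMultiplier A μ = NonZeroF μ × ∃ λ g → ∀ x →
      ((∃ λ a → a ∈ A × μ ⊗ a ≡ x) → (∃ λ a → a ∈ A × a ⊕ g ≡ x))
    × ((∃ λ a → a ∈ A × a ⊕ g ≡ x) → (∃ λ a → a ∈ A × μ ⊗ a ≡ x))

  EnumeratesMultipliers : Subset p → List (Fin p) → Set
  EnumeratesMultipliers A L =
    Unique L × (∀ μ → (μ LM.∈ L → IsMultiplier A μ) × (IsMultiplier A μ → μ LM.∈ L))

-- Inversion μ ↦ μ⁻¹ is an involution of the multiplier group M_A whose only possible
-- fixed points are the square roots 1 and -1 of unity, so |M_A| is odd as soon as
-- -1 ∉ M_A. Suppose -1 were a multiplier, -A = A + g, and send a ∈ A to the a′ ∈ A with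
-- a′ + g = -a. Then (b′, a′) represents the same difference as (a, b), so uniqueness of
-- representations gives b′ = a whenever a ≠ b; hence A has at most two elements and
-- A - A at most two non-zero differences, whereas 1, 4 and 9 are three distinct
-- non-zero squares modulo a prime p > 5.
module Submission where

open import Defs
open import Data.Nat using (ℕ; _<_; NonZero)
open import Data.Nat.DivMod using (_%_)
open import Data.Nat.Primality using (Prime)
open import Data.Fin.Subset using (Subset)
open import Data.List using (List; length)
open import Data.Product using (_×_)
open import Relation.Binary.PropositionalEquality using (_≡_)
open import Relation.Nullary using (¬_)

open import Data.Nat as ℕ using (zero; suc; _≤_; s≤s)
import Data.Nat.Properties as ℕ
import Data.Nat.Divisibility as ℕ
open import Data.Nat.DivMod using ([m+kn]%n≡m%n)
open import Data.Nat.Divisibility using (divides-refl)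
open import Data.Nat.GCD using (module Bézout)
open import Data.Nat.Coprimality using (coprime-Bézout; prime⇒coprime)
open import Data.Nat.Induction using (<-wellFounded)
open import Data.Nat.Primality
  using (euclidsLemma; ¬prime[1]; prime⇒¬composite; composite-∣; composite-≢; composite[4])
open import Data.Integer as ℤ using (ℤ; +_; _+_; _-_; _*_; -_; 0ℤ; 1ℤ; -1ℤ; _%ℕ_; _/ℕ_)
import Data.Integer.Properties as ℤ
open import Data.Integer.DivMod using (n%ℕd<d; a≡a%ℕn+[a/ℕn]*n)
open import Data.Integer.Divisibility.Signed
  using (_∣_; divides; ∣ᵤ⇒∣; ∣⇒∣ᵤ; ∣m⇒∣-m; ∣m∣n⇒∣m+n; ∣m⇒∣m*n; ∣n⇒∣m*n)
open import Data.Integer.Tactic.RingSolver using (solve-∀)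
open import Data.Fin as Fin using (Fin; toℕ; fromℕ<)
open import Data.Fin.Properties using (toℕ-fromℕ<; toℕ<n; toℕ-injective)
open import Data.List using ([]; _∷_; filter)
open import Data.List.Properties using (filter-accept; filter-reject; filter-all)
import Data.List.Membership.Propositional as LM
open import Data.List.Membership.Propositional.Properties using (∈-filter⁺; ∈-filter⁻)
open import Data.List.Relation.Unary.Any using (here; there)
import Data.List.Relation.Unary.All as All
open import Data.List.Relation.Unary.All.Properties using (All¬⇒¬Any)
open import Data.List.Relation.Unary.AllPairs using (_∷_)
open import Data.List.Relation.Unary.Unique.Propositional using (Unique)
import Data.List.Relation.Unary.Unique.Propositional.Properties as Unique
open import Data.Product using (Σ; ∃; ∃-syntax; _,_; proj₁; proj₂)
open import Data.Sum as Sum using (_⊎_; inj₁; inj₂)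
open import Data.Empty using (⊥-elim)
open import Function using (_∘_)
open import Induction.WellFounded using (Acc; acc)
open import Level using (0ℓ)
open import Relation.Binary.Bundles using (Setoid)
open import Relation.Binary.Definitions using (DecidableEquality)
open import Relation.Unary using (Decidable)
open import Relation.Binary.Structures using (IsEquivalence)
open import Relation.Binary.PropositionalEquality as ≡ using (_≢_; refl; cong; subst)
import Relation.Binary.Reasoning.Setoid as SetoidReasoning
open import Relation.Nullary using (yes; no; ¬?)

Even : ℕ → Set
Even n = ∃[ k ] n ≡ k ℕ.* 2

module Involution {X : Set} (_≟_ : DecidableEquality X) (f : X → X) where
  open LM using (_∈_)

  ClosedOn InvolutiveOn FixedPointFreeOn : List X → Set
  ClosedOn L = ∀ {x} → x ∈ L → f x ∈ L
  InvolutiveOn L = ∀ {x} → x ∈ L → f (f x) ≡ x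
  FixedPointFreeOn L = ∀ {x} → x ∈ L → f x ≢ x

  private
    ≢? : ∀ y → Decidable (_≢ y)
    ≢? y x = ¬? (x ≟ y)

  infixl 5 _without_
  _without_ : List X → X → List X
  xs without y = filter (≢? y) xs

  ∈-without⁺ : ∀ {xs y u} → u ∈ xs → u ≢ y → u ∈ xs without y
  ∈-without⁺ = ∈-filter⁺ (≢? _)

  ∈-without⁻ : ∀ {xs y u} → u ∈ xs without y → u ∈ xs × u ≢ y
  ∈-without⁻ = ∈-filter⁻ (≢? _)

  without-unique : ∀ {xs} y → Unique xs → Unique (xs without y)
  without-unique y = Unique.filter⁺ (≢? y)

  length-without : ∀ {xs y} → Unique xs → y ∈ xs → length xs ≡ suc (length (xs without y))
  length-without {x ∷ xs} (x∉xs ∷ _) (here refl) = cong suc (≡.sym (cong length (begin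
    (x ∷ xs) without x  ≡⟨ filter-reject (≢? x) (λ x≢x → x≢x refl) ⟩
    xs without x        ≡⟨ filter-all (≢? x) (All.map (_∘ ≡.sym) x∉xs) ⟩
    xs                  ∎)))
    where open ≡.≡-Reasoning
  length-without {x ∷ xs} {y} (x∉xs ∷ uxs) (there y∈xs) =
    cong suc (≡.trans (length-without uxs y∈xs) (cong length (≡.sym (filter-accept (≢? y) x≢y))))
    where x≢y : x ≢ y
          x≢y refl = All¬⇒¬Any x∉xs y∈xs

  fixedPointFree⇒even-length : ∀ {L} → Unique L → ClosedOn L → InvolutiveOn L → FixedPointFreeOn L →
                               Even (length L)
  fixedPointFree⇒even-length = go (<-wellFounded _)
    where
    go : ∀ {L} → Acc _<_ (length L) →
         Unique L → ClosedOn L → InvolutiveOn L → FixedPointFreeOn L → Even (length L)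
    go {[]} _ _ _ _ _ = 0 , refl
    go {x ∷ xs} (acc rec) (x∉xs ∷ uxs) closed involutive free =
      let k , |ys|≡2k = go (rec shorter) (without-unique (f x) uxs) closedʸ
                           (involutive ∘ there ∘ proj₁ ∘ ∈-without⁻)
                           (free ∘ there ∘ proj₁ ∘ ∈-without⁻)
      in suc k , cong suc (≡.trans |xs| (cong suc |ys|≡2k))
      where
      ys = xs without f x
      fx∈xs : f x ∈ xs
      fx∈xs with closed (here refl)
      ... | here fx≡x   = ⊥-elim (free (here refl) fx≡x)
      ... | there fx∈xs = fx∈xs
      |xs| : length xs ≡ suc (length ys)
      |xs| = length-without uxs fx∈xs
      shorter : length ys < length (x ∷ xs)
      shorter = ℕ.m≤n⇒m≤1+n (ℕ.≤-reflexive (≡.sym |xs|))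
      closedʸ : ClosedOn ys
      closedʸ {u} u∈ys with ∈-without⁻ u∈ys
      ... | u∈xs , u≢fx with closed (there u∈xs)
      ...   | here fu≡x   = ⊥-elim (u≢fx (≡.trans (≡.sym (involutive (there u∈xs))) (cong f fu≡x)))
      ...   | there fu∈xs =
        ∈-without⁺ fu∈xs λ fu≡fx → All¬⇒¬Any x∉xs (subst (_∈ xs) (u≡x fu≡fx) u∈xs)
        where u≡x : f u ≡ f x → u ≡ x
              u≡x fu≡fx = ≡.trans (≡.sym (involutive (there u∈xs)))
                                  (≡.trans (cong f fu≡fx) (involutive (here refl)))

  uniqueFixedPoint⇒odd-length : ∀ {L e} → Unique L → ClosedOn L → InvolutiveOn L →
                                e ∈ L → f e ≡ e → (∀ {x} → x ∈ L → f x ≡ x → x ≡ e) →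
                                length L % 2 ≡ 1
  uniqueFixedPoint⇒odd-length {L} {e} uL closed involutive e∈L fe≡e fixed =
    let k , |L-e|≡2k = fixedPointFree⇒even-length (without-unique e uL) closedʸ
                         (involutive ∘ proj₁ ∘ ∈-without⁻) free
    in ≡.trans (cong (_% 2) (≡.trans (length-without uL e∈L) (cong suc |L-e|≡2k)))
               ([m+kn]%n≡m%n 1 k 2)
    where
    closedʸ : ClosedOn (L without e)
    closedʸ u∈ with ∈-without⁻ u∈
    ... | u∈L , u≢e = ∈-without⁺ (closed u∈L) λ fu≡e →
                        u≢e (≡.trans (≡.sym (involutive u∈L)) (≡.trans (cong f fu≡e) fe≡e))
    free : FixedPointFreeOn (L without e)
    free u∈ fu≡u with ∈-without⁻ u∈
    ... | u∈L , u≢e = u≢e (fixed u∈L fu≡u)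

module Congruence (n : ℤ) where

  -- A record rather than n ∣ x - y itself, so that x and y can be inferred.
  infix 4 _≈_
  record _≈_ (x y : ℤ) : Set where
    constructor mod
    field ∣-difference : n ∣ x - y

  private
    ≈-by : ∀ {x y i} → x - y ≡ i → n ∣ i → x ≈ y
    ≈-by x-y≡i n∣i = mod (subst (n ∣_) (≡.sym x-y≡i) n∣i)

  ≈-reflexive : ∀ {x y} → x ≡ y → x ≈ y
  ≈-reflexive {x} refl = ≈-by (eq x n) (divides 0ℤ refl)
    where eq : ∀ x n → x - x ≡ 0ℤ * n
          eq = solve-∀

  ≈-refl : ∀ {x} → x ≈ x
  ≈-refl = ≈-reflexive refl

  ≈-sym : ∀ {x y} → x ≈ y → y ≈ x
  ≈-sym {x} {y} (mod x≈y) = ≈-by (eq x y) (∣m⇒∣-m x≈y)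
    where eq : ∀ x y → y - x ≡ - (x - y)
          eq = solve-∀

  ≈-trans : ∀ {x y z} → x ≈ y → y ≈ z → x ≈ z
  ≈-trans {x} {y} {z} (mod x≈y) (mod y≈z) = ≈-by (eq x y z) (∣m∣n⇒∣m+n x≈y y≈z)
    where eq : ∀ x y z → x - z ≡ (x - y) + (y - z)
          eq = solve-∀

  ≈-isEquivalence : IsEquivalence _≈_
  ≈-isEquivalence = record { refl = ≈-refl ; sym = ≈-sym ; trans = ≈-trans }

  ≈-setoid : Setoid 0ℓ 0ℓ
  ≈-setoid = record { isEquivalence = ≈-isEquivalence }

  module ≈-Reasoning = SetoidReasoning ≈-setoid

  +-cong : ∀ {x y u v} → x ≈ y → u ≈ v → x + u ≈ y + v
  +-cong {x} {y} {u} {v} (mod x≈y) (mod u≈v) = ≈-by (eq x y u v) (∣m∣n⇒∣m+n x≈y u≈v)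
    where eq : ∀ x y u v → (x + u) - (y + v) ≡ (x - y) + (u - v)
          eq = solve-∀

  *-cong : ∀ {x y u v} → x ≈ y → u ≈ v → x * u ≈ y * v
  *-cong {x} {y} {u} {v} (mod x≈y) (mod u≈v) =
    ≈-by (eq x y u v) (∣m∣n⇒∣m+n (∣m⇒∣m*n u x≈y) (∣n⇒∣m*n y u≈v))
    where eq : ∀ x y u v → x * u - y * v ≡ (x - y) * u + y * (u - v)
          eq = solve-∀

  -‿cong : ∀ {x y} → x ≈ y → - x ≈ - y
  -‿cong {x} {y} (mod x≈y) = ≈-by (eq x y) (∣m⇒∣-m x≈y)
    where eq : ∀ x y → - x - - y ≡ - (x - y)
          eq = solve-∀

  left-inverse-unique : ∀ {μ ν ρ} → ν * μ ≈ 1ℤ → ρ * ν ≈ 1ℤ → ρ ≈ μ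
  left-inverse-unique {μ} {ν} {ρ} νμ≈1 ρν≈1 = begin
    ρ            ≡⟨ ℤ.*-identityʳ ρ ⟨
    ρ * 1ℤ       ≈⟨ *-cong (≈-refl {ρ}) νμ≈1 ⟨
    ρ * (ν * μ)  ≡⟨ ℤ.*-assoc ρ ν μ ⟨
    ρ * ν * μ    ≈⟨ *-cong ρν≈1 (≈-refl {μ}) ⟩
    1ℤ * μ       ≡⟨ ℤ.*-identityˡ μ ⟩
    μ            ∎
    where open ≈-Reasoning

module PrimeCongruence {p : ℕ} (p-prime : Prime p) where
  open Congruence (+ p)

  ∣*⇒∣⊎∣ : ∀ {i j} → + p ∣ i * j → (+ p ∣ i) ⊎ (+ p ∣ j)
  ∣*⇒∣⊎∣ {i} {j} p∣ij
    with euclidsLemma ℤ.∣ i ∣ ℤ.∣ j ∣ p-prime (subst (p ℕ.∣_) (ℤ.abs-* i j) (∣⇒∣ᵤ p∣ij))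
  ... | inj₁ p∣i = inj₁ (∣ᵤ⇒∣ p∣i)
  ... | inj₂ p∣j = inj₂ (∣ᵤ⇒∣ p∣j)

  square≈1 : ∀ {x} → x * x ≈ 1ℤ → x ≈ 1ℤ ⊎ x ≈ -1ℤ
  square≈1 {x} (mod p∣x²-1) = Sum.map mod mod (∣*⇒∣⊎∣ (subst (+ p ∣_) (eq x) p∣x²-1))
    where eq : ∀ x → x * x - 1ℤ ≡ (x - 1ℤ) * (x - -1ℤ)
          eq = solve-∀

  1≉0 : ¬ 1ℤ ≈ 0ℤ
  1≉0 (mod p∣1) with ℕ.∣1⇒≡1 (∣⇒∣ᵤ p∣1)
  ... | refl = ¬prime[1] p-prime

module Residues (p : ℕ) .{{_ : NonZero p}} where
  open Congruence (+ p) public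

  ⟦_⟧ : Fin p → ℤ
  ⟦ x ⟧ = + toℕ x

  reduce : ℤ → Fin p
  reduce i = fromℕ< (n%ℕd<d i p)

  one : Fin p
  one = reduce 1ℤ

  ⟦reduce⟧ : ∀ i → ⟦ reduce i ⟧ ≈ i
  ⟦reduce⟧ i = ≈-trans (≈-reflexive (cong +_ (toℕ-fromℕ< (n%ℕd<d i p)))) (mod (divides (- q) r-i≡-q*p))
    where
    r = i %ℕ p
    q = i /ℕ p
    eq : ∀ r q n → r - (r + q * n) ≡ (- q) * n
    eq = solve-∀
    r-i≡-q*p : + r - i ≡ (- q) * + p
    r-i≡-q*p = begin
      + r - i                ≡⟨ cong (λ j → + r - j) (a≡a%ℕn+[a/ℕn]*n i p) ⟩
      + r - (+ r + q * + p)  ≡⟨ eq (+ r) q (+ p) ⟩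
      (- q) * + p            ∎
      where open ≡.≡-Reasoning

  ⟦⊕⟧ : ∀ x y → ⟦ x ⊕ y ⟧ ≈ ⟦ x ⟧ + ⟦ y ⟧
  ⟦⊕⟧ x y = ≈-trans (⟦reduce⟧ (+ (toℕ x ℕ.+ toℕ y))) (≈-reflexive (ℤ.pos-+ (toℕ x) (toℕ y)))

  ⟦⊗⟧ : ∀ x y → ⟦ x ⊗ y ⟧ ≈ ⟦ x ⟧ * ⟦ y ⟧
  ⟦⊗⟧ x y = ≈-trans (⟦reduce⟧ (+ (toℕ x ℕ.* toℕ y))) (≈-reflexive (ℤ.pos-* (toℕ x) (toℕ y)))

  +[p∸m]≈-m : ∀ {m} → m ≤ p → + (p ℕ.∸ m) ≈ - + m
  +[p∸m]≈-m {m} m≤p = mod (divides 1ℤ (begin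
    + (p ℕ.∸ m) - - + m  ≡⟨ eq (+ (p ℕ.∸ m)) (+ m) ⟩
    + (p ℕ.∸ m) + + m    ≡⟨ ℤ.pos-+ (p ℕ.∸ m) m ⟨
    + (p ℕ.∸ m ℕ.+ m)    ≡⟨ cong +_ (ℕ.m∸n+n≡m m≤p) ⟩
    + p                  ≡⟨ ℤ.*-identityˡ (+ p) ⟨
    1ℤ * + p             ∎))
    where
    open ≡.≡-Reasoning
    eq : ∀ a b → a - - b ≡ a + b
    eq = solve-∀

  ⟦⊖⟧ : ∀ x y → ⟦ x ⊖ y ⟧ ≈ ⟦ x ⟧ - ⟦ y ⟧
  ⟦⊖⟧ x y = begin
    ⟦ x ⊖ y ⟧                    ≈⟨ ⟦reduce⟧ (+ (toℕ x ℕ.+ (p ℕ.∸ toℕ y))) ⟩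
    + (toℕ x ℕ.+ (p ℕ.∸ toℕ y))  ≡⟨ ℤ.pos-+ (toℕ x) (p ℕ.∸ toℕ y) ⟩
    ⟦ x ⟧ + + (p ℕ.∸ toℕ y)      ≈⟨ +-cong (≈-refl {⟦ x ⟧}) (+[p∸m]≈-m (ℕ.<⇒≤ (toℕ<n y))) ⟩
    ⟦ x ⟧ - ⟦ y ⟧                ∎
    where open ≈-Reasoning

  ⟦minusOne⟧ : ⟦ minusOne ⟧ ≈ -1ℤ
  ⟦minusOne⟧ = ≈-trans (⟦reduce⟧ (+ (p ℕ.∸ 1))) (+[p∸m]≈-m (ℕ.n≢0⇒n>0 (ℕ.≢-nonZero⁻¹ p)))

  +-≈-injective : ∀ {m n} → m < p → n < p → + m ≈ + n → m ≡ n
  +-≈-injective {m} {n} m<p n<p (mod p∣m-n) =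
    ℤ.+-injective (ℤ.i-j≡0⇒i≡j (+ m) (+ n) (ℤ.∣i∣≡0⇒i≡0 (∣small⇒≡0 ∣m-n∣<p (∣⇒∣ᵤ p∣m-n))))
    where
    ∣small⇒≡0 : ∀ {k} → k < p → p ℕ.∣ k → k ≡ 0
    ∣small⇒≡0 {zero}  _   _   = refl
    ∣small⇒≡0 {suc _} k<p p∣k = ⊥-elim (ℕ.>⇒∤ k<p p∣k)
    ∣m-n∣<p : ℤ.∣ + m - + n ∣ < p
    ∣m-n∣<p = subst (_< p) (cong ℤ.∣_∣ (≡.sym (ℤ.[+m]-[+n]≡m⊖n m n)))
                (ℕ.≤-<-trans (ℤ.∣m⊝n∣≤m⊔n m n) (ℕ.⊔-lub m<p n<p))

  ⟦⟧-injective : ∀ {x y} → ⟦ x ⟧ ≈ ⟦ y ⟧ → x ≡ y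
  ⟦⟧-injective {x} {y} = toℕ-injective ∘ +-≈-injective (toℕ<n x) (toℕ<n y)

  nonZero⇒≉0 : ∀ {x} → NonZeroF x → ¬ ⟦ x ⟧ ≈ 0ℤ
  nonZero⇒≉0 {x} x≢0 = x≢0 ∘ +-≈-injective (toℕ<n x) (ℕ.n≢0⇒n>0 (ℕ.≢-nonZero⁻¹ p))

  ≉0⇒nonZero : ∀ {x} → ¬ ⟦ x ⟧ ≈ 0ℤ → NonZeroF x
  ≉0⇒nonZero x≉0 x≡0 = x≉0 (≈-reflexive (cong +_ x≡0))

  ⊖≡QR⇒≢ : ∀ {r u v} → IsQR r → u ⊖ v ≡ r → u ≢ v
  ⊖≡QR⇒≢ {u = u} (r≢0 , _) u-u≡r refl =
    nonZero⇒≉0 (subst NonZeroF (≡.sym u-u≡r) r≢0)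
               (≈-trans (⟦⊖⟧ u u) (≈-reflexive (ℤ.+-inverseʳ ⟦ u ⟧)))

  one⊗ : ∀ a → one ⊗ a ≡ a ⊕ reduce 0ℤ
  one⊗ a = ⟦⟧-injective (begin
    ⟦ one ⊗ a ⟧            ≈⟨ ⟦⊗⟧ one a ⟩
    ⟦ one ⟧ * ⟦ a ⟧        ≈⟨ *-cong (⟦reduce⟧ 1ℤ) (≈-refl {⟦ a ⟧}) ⟩
    1ℤ * ⟦ a ⟧             ≡⟨ eq ⟦ a ⟧ ⟩
    ⟦ a ⟧ + 0ℤ             ≈⟨ +-cong (≈-refl {⟦ a ⟧}) (⟦reduce⟧ 0ℤ) ⟨
    ⟦ a ⟧ + ⟦ reduce 0ℤ ⟧  ≈⟨ ⟦⊕⟧ a (reduce 0ℤ) ⟨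
    ⟦ a ⊕ reduce 0ℤ ⟧      ∎)
    where
    open ≈-Reasoning
    eq : ∀ a → 1ℤ * a ≡ a + 0ℤ
    eq = solve-∀

  ⊗-affine-inverse : ∀ {μ ν u v g} → ⟦ ν ⟧ * ⟦ μ ⟧ ≈ 1ℤ → μ ⊗ u ≡ v ⊕ g →
                     u ⊕ reduce (- (⟦ ν ⟧ * ⟦ g ⟧)) ≡ ν ⊗ v
  ⊗-affine-inverse {μ} {ν} {u} {v} {g} νμ≈1 μu≡v+g = ⟦⟧-injective (begin
    ⟦ u ⊕ g′ ⟧                 ≈⟨ ⟦⊕⟧ u g′ ⟩
    ⟦ u ⟧ + ⟦ g′ ⟧             ≈⟨ +-cong (≈-refl {⟦ u ⟧}) (⟦reduce⟧ (- (N * G))) ⟩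
    ⟦ u ⟧ - N * G              ≡⟨ eq₁ ⟦ u ⟧ (N * G) ⟩
    1ℤ * ⟦ u ⟧ - N * G         ≈⟨ +-cong (*-cong νμ≈1 (≈-refl {⟦ u ⟧})) (≈-refl { - (N * G)}) ⟨
    N * ⟦ μ ⟧ * ⟦ u ⟧ - N * G  ≡⟨ eq₂ N ⟦ μ ⟧ ⟦ u ⟧ G ⟩
    N * (⟦ μ ⟧ * ⟦ u ⟧ - G)    ≈⟨ *-cong (≈-refl {N}) (+-cong (⟦⊗⟧ μ u) (≈-refl { - G})) ⟨
    N * (⟦ μ ⊗ u ⟧ - G)        ≡⟨ cong (λ w → N * (⟦ w ⟧ - G)) μu≡v+g ⟩
    N * (⟦ v ⊕ g ⟧ - G)        ≈⟨ *-cong (≈-refl {N}) (+-cong (⟦⊕⟧ v g) (≈-refl { - G})) ⟩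
    N * (⟦ v ⟧ + G - G)        ≡⟨ eq₃ N ⟦ v ⟧ G ⟩
    N * ⟦ v ⟧                  ≈⟨ ⟦⊗⟧ ν v ⟨
    ⟦ ν ⊗ v ⟧                  ∎)
    where
    open ≈-Reasoning
    N = ⟦ ν ⟧
    G = ⟦ g ⟧
    g′ = reduce (- (N * G))
    eq₁ : ∀ u k → u - k ≡ 1ℤ * u - k
    eq₁ = solve-∀
    eq₂ : ∀ n m u g → n * m * u - n * g ≡ n * (m * u - g)
    eq₂ = solve-∀
    eq₃ : ∀ n v g → n * (v + g - g) ≡ n * v
    eq₃ = solve-∀

  reflected-difference : ∀ {a b a′ b′ g} → a′ ⊕ g ≡ minusOne ⊗ a → b′ ⊕ g ≡ minusOne ⊗ b →
                         b′ ⊖ a′ ≡ a ⊖ b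
  reflected-difference {a} {b} {a′} {b′} {g} a′+g≡-a b′+g≡-b = ⟦⟧-injective (begin
    ⟦ b′ ⊖ a′ ⟧                          ≈⟨ ⟦⊖⟧ b′ a′ ⟩
    ⟦ b′ ⟧ - ⟦ a′ ⟧                      ≡⟨ eq₁ ⟦ b′ ⟧ ⟦ a′ ⟧ ⟦ g ⟧ ⟩
    (⟦ b′ ⟧ + ⟦ g ⟧) - (⟦ a′ ⟧ + ⟦ g ⟧)  ≈⟨ +-cong (reflect b′+g≡-b) (-‿cong (reflect a′+g≡-a)) ⟩
    - ⟦ b ⟧ - - ⟦ a ⟧                    ≡⟨ eq₂ ⟦ a ⟧ ⟦ b ⟧ ⟩
    ⟦ a ⟧ - ⟦ b ⟧                        ≈⟨ ⟦⊖⟧ a b ⟨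
    ⟦ a ⊖ b ⟧                            ∎)
    where
    open ≈-Reasoning
    reflect : ∀ {c c′} → c′ ⊕ g ≡ minusOne ⊗ c → ⟦ c′ ⟧ + ⟦ g ⟧ ≈ - ⟦ c ⟧
    reflect {c} {c′} c′+g≡-c = begin
      ⟦ c′ ⟧ + ⟦ g ⟧        ≈⟨ ⟦⊕⟧ c′ g ⟨
      ⟦ c′ ⊕ g ⟧            ≡⟨ cong ⟦_⟧ c′+g≡-c ⟩
      ⟦ minusOne ⊗ c ⟧      ≈⟨ ⟦⊗⟧ minusOne c ⟩
      ⟦ minusOne ⟧ * ⟦ c ⟧  ≈⟨ *-cong ⟦minusOne⟧ (≈-refl {⟦ c ⟧}) ⟩
      -1ℤ * ⟦ c ⟧           ≡⟨ ℤ.-1*i≡-i ⟦ c ⟧ ⟩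
      - ⟦ c ⟧               ∎
    eq₁ : ∀ b a g → b - a ≡ (b + g) - (a + g)
    eq₁ = solve-∀
    eq₂ : ∀ a b → - b - - a ≡ a - b
    eq₂ = solve-∀

module Inverses {p : ℕ} .{{_ : NonZero p}} (p-prime : Prime p) where
  open Residues p
  open PrimeCongruence p-prime

  one-nonZero : NonZeroF one
  one-nonZero = ≉0⇒nonZero (1≉0 ∘ ≈-trans (≈-sym (⟦reduce⟧ 1ℤ)))

  private
    cast : ∀ k a b c d → k ℕ.+ a ℕ.* b ≡ c ℕ.* d → + k + + a * + b ≡ + c * + d
    cast k a b c d eq = begin
      + k + + a * + b    ≡⟨ cong (λ j → + k + j) (ℤ.pos-* a b) ⟨
      + k + + (a ℕ.* b)  ≡⟨ ℤ.pos-+ k (a ℕ.* b) ⟨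
      + (k ℕ.+ a ℕ.* b)  ≡⟨ cong +_ eq ⟩
      + (c ℕ.* d)        ≡⟨ ℤ.pos-* c d ⟩
      + c * + d          ∎
      where open ≡.≡-Reasoning

  bézoutInverse : ∀ {m} → Bézout.Identity 1 p m → ℤ
  bézoutInverse (Bézout.+- _ y _) = - + y
  bézoutInverse (Bézout.-+ _ y _) = + y

  bézoutInverse-inverse : ∀ {m} (b : Bézout.Identity 1 p m) → bézoutInverse b * + m ≈ 1ℤ
  bézoutInverse-inverse {m} (Bézout.+- x y eq) = mod (divides (- + x) (begin
    (- + y) * + m - 1ℤ  ≡⟨ eq₁ (+ y) (+ m) ⟩
    - (1ℤ + + y * + m)  ≡⟨ cong -_ (cast 1 y m x p eq) ⟩
    - (+ x * + p)       ≡⟨ ℤ.neg-distribˡ-* (+ x) (+ p) ⟩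
    (- + x) * + p       ∎))
    where
    open ≡.≡-Reasoning
    eq₁ : ∀ y m → (- y) * m - 1ℤ ≡ - (1ℤ + y * m)
    eq₁ = solve-∀
  bézoutInverse-inverse {m} (Bézout.-+ x y eq) = mod (divides (+ x) (begin
    + y * + m - 1ℤ         ≡⟨ cong (_- 1ℤ) (cast 1 x p y m eq) ⟨
    (1ℤ + + x * + p) - 1ℤ  ≡⟨ eq₁ (+ x * + p) ⟩
    + x * + p              ∎))
    where
    open ≡.≡-Reasoning
    eq₁ : ∀ k → (1ℤ + k) - 1ℤ ≡ k
    eq₁ = solve-∀

  bézout : ∀ {μ} → NonZeroF μ → Bézout.Identity 1 p (toℕ μ)
  bézout {μ} μ≢0 = coprime-Bézout (prime⇒coprime p-prime {{ℕ.≢-nonZero μ≢0}} (toℕ<n μ))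

  -- 0 ⁻¹ is the junk value 0.
  infix 8 _⁻¹
  _⁻¹ : Fin p → Fin p
  μ ⁻¹ with toℕ μ ℕ.≟ 0
  ... | yes _  = μ
  ... | no μ≢0 = reduce (bézoutInverse (bézout μ≢0))

  ⁻¹-inverseˡ : ∀ {μ} → NonZeroF μ → ⟦ μ ⁻¹ ⟧ * ⟦ μ ⟧ ≈ 1ℤ
  ⁻¹-inverseˡ {μ} μ≢0 with toℕ μ ℕ.≟ 0
  ... | yes μ≡0 = ⊥-elim (μ≢0 μ≡0)
  ... | no μ≢0  = ≈-trans (*-cong (⟦reduce⟧ (bézoutInverse (bézout μ≢0))) (≈-refl {⟦ μ ⟧}))
                          (bézoutInverse-inverse (bézout μ≢0))

  ⁻¹-nonZero : ∀ {μ} → NonZeroF μ → NonZeroF (μ ⁻¹)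
  ⁻¹-nonZero {μ} μ≢0 = ≉0⇒nonZero λ μ⁻¹≈0 → 1≉0 (begin
    1ℤ                   ≈⟨ ⁻¹-inverseˡ μ≢0 ⟨
    ⟦ μ ⁻¹ ⟧ * ⟦ μ ⟧     ≈⟨ *-cong μ⁻¹≈0 (≈-refl {⟦ μ ⟧}) ⟩
    0ℤ * ⟦ μ ⟧           ≡⟨ ℤ.*-zeroˡ ⟦ μ ⟧ ⟩
    0ℤ                   ∎)
    where open ≈-Reasoning

  ⁻¹-involutive : ∀ {μ} → NonZeroF μ → μ ⁻¹ ⁻¹ ≡ μ
  ⁻¹-involutive μ≢0 =
    ⟦⟧-injective (left-inverse-unique (⁻¹-inverseˡ μ≢0) (⁻¹-inverseˡ (⁻¹-nonZero μ≢0)))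

  one⁻¹ : one ⁻¹ ≡ one
  one⁻¹ = ⟦⟧-injective (begin
    ⟦ one ⁻¹ ⟧            ≡⟨ ℤ.*-identityʳ ⟦ one ⁻¹ ⟧ ⟨
    ⟦ one ⁻¹ ⟧ * 1ℤ       ≈⟨ *-cong (≈-refl {⟦ one ⁻¹ ⟧}) (⟦reduce⟧ 1ℤ) ⟨
    ⟦ one ⁻¹ ⟧ * ⟦ one ⟧  ≈⟨ ⁻¹-inverseˡ one-nonZero ⟩
    1ℤ                    ≈⟨ ⟦reduce⟧ 1ℤ ⟨
    ⟦ one ⟧               ∎)
    where open ≈-Reasoning

  ⁻¹-fixed : ∀ {μ} → NonZeroF μ → μ ⁻¹ ≡ μ → μ ≡ one ⊎ μ ≡ minusOne
  ⁻¹-fixed {μ} μ≢0 μ⁻¹≡μ with square≈1 (subst (λ ν → ⟦ ν ⟧ * ⟦ μ ⟧ ≈ 1ℤ) μ⁻¹≡μ (⁻¹-inverseˡ μ≢0))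
  ... | inj₁ μ≈1  = inj₁ (⟦⟧-injective (≈-trans μ≈1 (≈-sym (⟦reduce⟧ 1ℤ))))
  ... | inj₂ μ≈-1 = inj₂ (⟦⟧-injective (≈-trans μ≈-1 (≈-sym ⟦minusOne⟧)))

module Multipliers {p : ℕ} .{{_ : NonZero p}} (p-prime : Prime p) (A : Subset p) where
  open import Data.Fin.Subset using (_∈_)
  open Residues p
  open Inverses p-prime
  open Involution Fin._≟_ _⁻¹

  one-isMultiplier : IsMultiplier A one
  one-isMultiplier = one-nonZero , reduce 0ℤ , λ x →
    (λ (a , a∈A , 1a≡x) → a , a∈A , ≡.trans (≡.sym (one⊗ a)) 1a≡x) ,
    (λ (a , a∈A , a+0≡x) → a , a∈A , ≡.trans (one⊗ a) a+0≡x)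

  ⁻¹-isMultiplier : ∀ {μ} → IsMultiplier A μ → IsMultiplier A (μ ⁻¹)
  ⁻¹-isMultiplier {μ} (μ≢0 , g , μA≡A+g) = ⁻¹-nonZero μ≢0 , g′ , λ x → to x , from x
    where
    g′ = reduce (- (⟦ μ ⁻¹ ⟧ * ⟦ g ⟧))
    affine : ∀ {u v} → μ ⊗ u ≡ v ⊕ g → u ⊕ g′ ≡ μ ⁻¹ ⊗ v
    affine {u} {v} = ⊗-affine-inverse {μ = μ} {μ ⁻¹} {u} {v} {g} (⁻¹-inverseˡ μ≢0)
    to : ∀ x → ∃ (λ a → a ∈ A × μ ⁻¹ ⊗ a ≡ x) → ∃ (λ a → a ∈ A × a ⊕ g′ ≡ x)
    to x (a , a∈A , μ⁻¹a≡x) with proj₂ (μA≡A+g (a ⊕ g)) (a , a∈A , refl)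
    ... | a″ , a″∈A , μa″≡a+g = a″ , a″∈A , ≡.trans (affine μa″≡a+g) μ⁻¹a≡x
    from : ∀ x → ∃ (λ a → a ∈ A × a ⊕ g′ ≡ x) → ∃ (λ a → a ∈ A × μ ⁻¹ ⊗ a ≡ x)
    from x (a , a∈A , a+g′≡x) with proj₁ (μA≡A+g (μ ⊗ a)) (a , a∈A , refl)
    ... | a″ , a″∈A , a″+g≡μa = a″ , a″∈A , ≡.trans (≡.sym (affine (≡.sym a″+g≡μa))) a+g′≡x

  multipliers-odd : ∀ {L} → ¬ IsMultiplier A minusOne → EnumeratesMultipliers A L → length L % 2 ≡ 1
  multipliers-odd {L} -1∉M (unique , L≡M) =
    uniqueFixedPoint⇒odd-length unique closed involutive
      (proj₂ (L≡M one) one-isMultiplier) one⁻¹ fixed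
    where
    multiplier : ∀ {μ} → μ LM.∈ L → IsMultiplier A μ
    multiplier {μ} = proj₁ (L≡M μ)
    closed : ClosedOn L
    closed {μ} μ∈L = proj₂ (L≡M (μ ⁻¹)) (⁻¹-isMultiplier (multiplier μ∈L))
    involutive : InvolutiveOn L
    involutive = ⁻¹-involutive ∘ proj₁ ∘ multiplier
    fixed : ∀ {μ} → μ LM.∈ L → μ ⁻¹ ≡ μ → μ ≡ one
    fixed μ∈L μ⁻¹≡μ with ⁻¹-fixed (proj₁ (multiplier μ∈L)) μ⁻¹≡μ
    ... | inj₁ μ≡one = μ≡one
    ... | inj₂ refl  = ⊥-elim (-1∉M (multiplier μ∈L))

AtMostTwo : {X : Set} → (X → Set) → Set
AtMostTwo P = ∀ {x y z} → P x → P y → P z → x ≡ y ⊎ x ≡ z ⊎ y ≡ z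

atMostTwo-pairs : ∀ {X : Set} {P : X → Set} → AtMostTwo P → ∀ {a b c d} → P a → P b → P c → P d →
                  a ≢ b → c ≢ d → (c ≡ a × d ≡ b) ⊎ (c ≡ b × d ≡ a)
atMostTwo-pairs atMostTwo pa pb pc pd a≢b c≢d with atMostTwo pa pb pc | atMostTwo pa pb pd
... | inj₁ a≡b         | _                = ⊥-elim (a≢b a≡b)
... | _                | inj₁ a≡b         = ⊥-elim (a≢b a≡b)
... | inj₂ (inj₁ refl) | inj₂ (inj₁ refl) = ⊥-elim (c≢d refl)
... | inj₂ (inj₁ refl) | inj₂ (inj₂ refl) = inj₁ (refl , refl)
... | inj₂ (inj₂ refl) | inj₂ (inj₁ refl) = inj₂ (refl , refl)
... | inj₂ (inj₂ refl) | inj₂ (inj₂ refl) = ⊥-elim (c≢d refl)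

record ThreeDistinctQRs (p : ℕ) .{{_ : NonZero p}} : Set where
  constructor distinctQRs
  field
    r₁ r₂ r₃ : Fin p
    qr₁ : IsQR r₁
    qr₂ : IsQR r₂
    qr₃ : IsQR r₃
    r₁≢r₂ : r₁ ≢ r₂
    r₁≢r₃ : r₁ ≢ r₃
    r₂≢r₃ : r₂ ≢ r₃

threeSquares : ∀ {p} .{{_ : NonZero p}} (x y z : Fin p) →
               NonZeroF (x ⊗ x) → NonZeroF (y ⊗ y) → NonZeroF (z ⊗ z) →
               x ⊗ x ≢ y ⊗ y → x ⊗ x ≢ z ⊗ z → y ⊗ y ≢ z ⊗ z → ThreeDistinctQRs p
threeSquares x y z x²≢0 y²≢0 z²≢0 =
  distinctQRs (x ⊗ x) (y ⊗ y) (z ⊗ z) (x²≢0 , x , refl) (y²≢0 , y , refl) (z²≢0 , z , refl)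

-- The squares of 1, 2 and 3; all side conditions are decided by evaluation.
threeDistinctQRs : ∀ p .{{_ : NonZero p}} → Prime p → 5 < p → ThreeDistinctQRs p
threeDistinctQRs 0 _ ()
threeDistinctQRs 1 _ (s≤s ())
threeDistinctQRs 2 _ (s≤s (s≤s ()))
threeDistinctQRs 3 _ (s≤s (s≤s (s≤s ())))
threeDistinctQRs 4 _ (s≤s (s≤s (s≤s (s≤s ()))))
threeDistinctQRs 5 _ (s≤s (s≤s (s≤s (s≤s (s≤s ())))))
threeDistinctQRs 6 _ _ = threeSquares (reduce 6 (+ 1)) (reduce 6 (+ 2)) (reduce 6 (+ 3))
  (λ ()) (λ ()) (λ ()) (λ ()) (λ ()) (λ ())
  where open Residues using (reduce)
threeDistinctQRs 7 _ _ = threeSquares (reduce 7 (+ 1)) (reduce 7 (+ 2)) (reduce 7 (+ 3))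
  (λ ()) (λ ()) (λ ()) (λ ()) (λ ()) (λ ())
  where open Residues using (reduce)
threeDistinctQRs 8 p-prime _ =
  ⊥-elim (prime⇒¬composite p-prime (composite-∣ composite[4] (divides-refl 2)))
threeDistinctQRs 9 p-prime _ =
  ⊥-elim (prime⇒¬composite p-prime (composite-≢ 3 (λ ()) (divides-refl 3)))
threeDistinctQRs p@(suc (suc (suc (suc (suc (suc (suc (suc (suc (suc _)))))))))) _ _ =
  threeSquares (reduce p (+ 1)) (reduce p (+ 2)) (reduce p (+ 3))
  (λ ()) (λ ()) (λ ()) (λ ()) (λ ()) (λ ())
  where open Residues using (reduce)

module _ {p : ℕ} .{{_ : NonZero p}} {A : Subset p} where
  open import Data.Fin.Subset using (_∈_)
  open Residues p

  minusOne-multiplier⇒atMostTwo : DiffIsQR A → IsMultiplier A minusOne → AtMostTwo (_∈ A)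
  minusOne-multiplier⇒atMostTwo (represent , differences) (_ , g , -A≡A+g) {x} {y} {z} x∈A y∈A z∈A
    with x Fin.≟ z | y Fin.≟ z
  ... | yes x≡z | _       = inj₂ (inj₁ x≡z)
  ... | no _    | yes y≡z = inj₂ (inj₂ y≡z)
  ... | no x≢z  | no y≢z  = inj₁ (≡.trans (≡.sym (swap x∈A z∈A x≢z)) (swap y∈A z∈A y≢z))
    where
    reflect : ∀ {a} → a ∈ A → Σ (Fin p) λ a′ → a′ ∈ A × a′ ⊕ g ≡ minusOne ⊗ a
    reflect a∈A = proj₁ (-A≡A+g _) (_ , a∈A , refl)
    swap : ∀ {a b} (a∈A : a ∈ A) (b∈A : b ∈ A) → a ≢ b → proj₁ (reflect b∈A) ≡ a
    swap {a} {b} a∈A b∈A a≢b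
      with represent (a ⊖ b) (differences a b a∈A b∈A a≢b) | reflect a∈A | reflect b∈A
    ... | _ , _ , unique | a′ , a′∈A , a′+g≡-a | b′ , b′∈A , b′+g≡-b =
      cong proj₁ (≡.trans (unique (b′ , a′) (b′∈A , a′∈A , b′-a′≡a-b))
                          (≡.sym (unique (a , b) (a∈A , b∈A , refl))))
      where b′-a′≡a-b = reflected-difference {a = a} {b} {a′} {b′} {g} a′+g≡-a b′+g≡-b

  diffIsQR⇒¬atMostTwo : DiffIsQR A → ThreeDistinctQRs p → ¬ AtMostTwo (_∈ A)
  diffIsQR⇒¬atMostTwo (represent , _) (distinctQRs r₁ r₂ r₃ qr₁ qr₂ qr₃ r₁≢r₂ r₁≢r₃ r₂≢r₃) atMostTwo
    with represent r₁ qr₁ | represent r₂ qr₂ | represent r₃ qr₃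
  ... | (a , b) , (a∈A , b∈A , a-b≡r₁) , _ | (c , d) , (c∈A , d∈A , c-d≡r₂) , _
      | (e , h) , (e∈A , h∈A , e-h≡r₃) , _
    with atMostTwo-pairs atMostTwo a∈A b∈A c∈A d∈A (⊖≡QR⇒≢ qr₁ a-b≡r₁) (⊖≡QR⇒≢ qr₂ c-d≡r₂)
       | atMostTwo-pairs atMostTwo a∈A b∈A e∈A h∈A (⊖≡QR⇒≢ qr₁ a-b≡r₁) (⊖≡QR⇒≢ qr₃ e-h≡r₃)
  ... | inj₁ (refl , refl) | _                  = r₁≢r₂ (≡.trans (≡.sym a-b≡r₁) c-d≡r₂)
  ... | inj₂ _             | inj₁ (refl , refl) = r₁≢r₃ (≡.trans (≡.sym a-b≡r₁) e-h≡r₃)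
  ... | inj₂ (refl , refl) | inj₂ (refl , refl) = r₂≢r₃ (≡.trans (≡.sym c-d≡r₂) e-h≡r₃)

lemma2p10 : (p : ℕ) .{{_ : NonZero p}} → Prime p → 5 < p → (A : Subset p) → DiffIsQR A
    → ((L : List _) → EnumeratesMultipliers A L → length L % 2 ≡ 1)
      × ¬ IsMultiplier A minusOne
lemma2p10 p p-prime 5<p A A-A≐R = (λ _ → multipliers-odd -1∉M) , -1∉M
  where
  open Multipliers p-prime A using (multipliers-odd)
  -1∉M : ¬ IsMultiplier A minusOne
  -1∉M -1∈M = diffIsQR⇒¬atMostTwo A-A≐R (threeDistinctQRs p p-prime 5<p)
                (minusOne-multiplier⇒atMostTwo A-A≐R -1∈M)
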